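{- Let $n$ be an odd positive integer and $a\in\mathbb{F}_{2^n}$ nonzero with $\operatorname{tr}(1/a)=1$. Let $D$ be the $n\times n$ matrix over $\mathbb{F}_{2^n}$ with rows and columns indexed by $0,1,\ldots,n-1$, whose entries are $D_{i,i}=1+a^{2^i}$, $D_{i,i+1 \bmod n}=1+a^{2^{i+1}}$ (so $D_{n-1,0}=1+a$), and all other entries equal to $1$. Let $\tilde p_{n-1}$ be the determinant of the $(n-1)\times(n-1)$ matrix obtained from $D$ by deleting row $n-1$ and column $0$. Then $$\tilde p_{n-1}=\frac{1}{a}\left(1+\frac{1}{a}\langle\{1,3,\ldots,n-2\}\rangle\right).$$
   Context: $\operatorname{tr}(x)=\sum_{i=0}^{n-1}x^{2^i}$ is the absolute trace of $\mathbb{F}_{2^n}$. For $c\in\mathbb{F}_{2^n}$ and $I\subseteq\{0,\ldots,n-1\}$, $c\langle I\rangle=\sum_{i\in I}c^{2^i}$; here $c=1/a$. The matrix $D$ is the Dickson matrix of the linearized polynomial $ax+a^2x^2+\operatorname{tr}(x)$, and $\tilde p_{n-1}$ is its $(n-1,0)$ cofactor (signs are irrelevant in characteristic $2$). -}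

module Defs where

open import Level using (Level)
open import Data.Nat as ℕ using (ℕ; zero; suc; _∸_; _^_)
open import Data.Nat.DivMod using (_%_)
open import Data.Fin as Fin using (Fin; toℕ; punchIn)
open import Data.List using (List; []; _∷_; filter; upTo)
open import Data.Bool using (Bool; if_then_else_)
open import Relation.Nullary.Decidable using (does)
open import Relation.Binary.PropositionalEquality using (_≡_)
open import Algebra.Bundles using (CommutativeRing)

module _ {c ℓ : Level} (R : CommutativeRing c ℓ) where
  open CommutativeRing R

  pow : Carrier → ℕ → Carrier
  pow x zero    = 1#
  pow x (suc k) = x * pow x k

  frob : Carrier → ℕ → Carrier
  frob x i = pow x (2 ^ i)

  sumℕ : ℕ → (ℕ → Carrier) → Carrier
  sumℕ zero    f = 0#
  sumℕ (suc n) f = sumℕ n f + f n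

  tr : ℕ → Carrier → Carrier
  tr n x = sumℕ n (frob x)

  -- c⟨I⟩ = Σ_{i∈I} c^(2^i), I given as a list of indices
  bracket : Carrier → List ℕ → Carrier
  bracket x []       = 0#
  bracket x (i ∷ is) = frob x i + bracket x is

  oddIdx : ℕ → List ℕ
  oddIdx n = filter (λ i → i % 2 ℕ.≟ 1) (upTo (n ∸ 1))

  sumFin : (m : ℕ) → (Fin m → Carrier) → Carrier
  sumFin zero    f = 0#
  sumFin (suc m) f = f Fin.zero + sumFin m (λ j → f (Fin.suc j))

  sgn : ℕ → Carrier
  sgn zero    = 1#
  sgn (suc j) = - sgn j

  det : (m : ℕ) → (Fin m → Fin m → Carrier) → Carrier
  det zero    M = 1#
  det (suc m) M =
    sumFin (suc m) (λ j → sgn (toℕ j) * (M Fin.zero j *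
      det m (λ r s → M (Fin.suc r) (punchIn j s))))

  Dmat : ℕ → Carrier → ℕ → ℕ → Carrier
  Dmat n a i j =
    if does (i ℕ.≟ j) then 1# + frob a i
    else if does (j ℕ.≟ (suc i) % suc (n ∸ 1)) then 1# + frob a (suc i)
    else 1#

  -- p̃_{n-1}: determinant of D with row n-1 and column 0 deleted
  -- (for n = suc m: rows 0..m-1 kept, columns 1..m kept)
  ptilde : ℕ → Carrier → Carrier
  ptilde n a = det (n ∸ 1) (λ r s → Dmat n a (toℕ r) (suc (toℕ s)))

module _ {c ℓ : Level} where
  open import Data.Product using (Σ)
  ∃-inv : (R : CommutativeRing c ℓ) → CommutativeRing.Carrier R → Set _
  ∃-inv R x = Σ Carrier (λ y → x * y ≈ 1#)
    where open CommutativeRing R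

-- In a field of order 2^n we have 1 + 1 = 0, so the determinant is the permanent. The minor
-- is J + B with J the all-ones matrix and B bidiagonal, row r of B carrying d_j = a^(2^(j+1))
-- in the columns j = r - 1 and j = r. By multilinearity, and because a permanent with a
-- repeated row vanishes, a row of ones absorbs the J-parts of all later rows; expanding along
-- the remaining sparse rows gives recurrences solved by (d₀ ⋯ d_{m-1}) (1 + Σ_{j even} 1/d_j),
-- where n = m + 1. Fermat's little theorem a^(2^n) = a turns d₀ ⋯ d_{m-1} = a^(2^n - 2) into
-- 1/a, and as 1/d_j = (1/a)^(2^(j+1)) and m is even, the alternating sum is (1/a)⟨{1, 3, …, n - 2}⟩.

module Submission where

open import Defs
open import Level using (Level)
open import Data.Nat using (ℕ; _^_)
open import Data.Nat.DivMod using (_%_)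
open import Data.Fin using (Fin)
open import Relation.Binary.PropositionalEquality using (_≡_)
open import Relation.Binary.PropositionalEquality.Properties as ≡ using ()
open import Relation.Nullary using (¬_)
open import Function.Bundles using (Inverse)
open import Algebra.Bundles using (CommutativeRing)

open import Data.Nat as ℕ using (zero; suc; _<_; _≤_; _≡ᵇ_; _<ᵇ_; s≤s; z≤n)
import Data.Nat.Properties as ℕ
import Data.Nat.DivMod as ℕ
open import Data.Fin as Fin using (toℕ; punchIn; punchOut)
import Data.Fin.Properties as Fin
open import Data.Fin.Permutation using (Permutation)
open import Data.Bool using (Bool; true; false; T; _∧_; _∨_; not)
open import Data.Bool.Properties using (T-∨; T-∧; T-≡; ∨-identityʳ)
open import Data.List using (List; []; _∷_; _++_; map; filter; applyUpTo; iterate)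
import Data.List.Properties as List
open import Data.List.Relation.Binary.Pointwise using (Pointwise; []; _∷_)
open import Data.Product using (∃; _,_)
open import Data.Sum using (_⊎_; inj₁; inj₂)
open import Data.Unit using (tt)
open import Data.Empty using (⊥; ⊥-elim)
open import Function using (_∘_; Equivalence)
open import Function.Definitions using (Injective)
import Function.Construct.Composition as Compose
import Function.Construct.Symmetry as Symmetry
open import Relation.Nullary using (Dec; yes; no)
open import Relation.Nullary.Decidable using (map′)
open import Relation.Binary.PropositionalEquality as ≡ using (_≢_)
import Relation.Binary.Reasoning.Setoid
open import Algebra.Bundles using (CommutativeMonoid)
import Algebra.Properties.CommutativeMonoid.Sum as MonoidSum

T-ext : ∀ {a b} → (T a → T b) → (T b → T a) → a ≡ b
T-ext {false} {false} _ _ = ≡.refl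
T-ext {false} {true}  _ g = ⊥-elim (g tt)
T-ext {true}  {false} f _ = ⊥-elim (f tt)
T-ext {true}  {true}  _ _ = ≡.refl

≡ᵇ-refl : ∀ i → (i ≡ᵇ i) ≡ true
≡ᵇ-refl zero    = ≡.refl
≡ᵇ-refl (suc i) = ≡ᵇ-refl i

≢⇒¬≡ᵇ : ∀ {i k} → i ≢ k → (i ≡ᵇ k) ≡ false
≢⇒¬≡ᵇ {i} {k} i≢k = T-ext (λ t → i≢k (ℕ.≡ᵇ⇒≡ i k t)) λ ()

≡ᵇ-sym : ∀ i j → (i ≡ᵇ j) ≡ (j ≡ᵇ i)
≡ᵇ-sym zero    zero    = ≡.refl
≡ᵇ-sym zero    (suc j) = ≡.refl
≡ᵇ-sym (suc i) zero    = ≡.refl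
≡ᵇ-sym (suc i) (suc j) = ≡ᵇ-sym i j

¬≡ᵇ⇒≢ : ∀ {i k} → T (not (i ≡ᵇ k)) → i ≢ k
¬≡ᵇ⇒≢ {i} t ≡.refl rewrite ≡ᵇ-refl i = t

≢⇒T¬≡ᵇ : ∀ {i k} → i ≢ k → T (not (i ≡ᵇ k))
≢⇒T¬≡ᵇ i≢k rewrite ≢⇒¬≡ᵇ i≢k = tt

%2≡0⇒suc%2≡1 : ∀ k → k % 2 ≡ 0 → suc k % 2 ≡ 1
%2≡0⇒suc%2≡1 zero          _ = ≡.refl
%2≡0⇒suc%2≡1 (suc (suc k)) p = %2≡0⇒suc%2≡1 k p

suc%2≡1⇒%2≡0 : ∀ k → suc k % 2 ≡ 1 → k % 2 ≡ 0
suc%2≡1⇒%2≡0 zero          _ = ≡.refl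
suc%2≡1⇒%2≡0 (suc (suc k)) p = suc%2≡1⇒%2≡0 k p

map-suc-iterate : ∀ k t → map suc (iterate suc k t) ≡ iterate suc (suc k) t
map-suc-iterate k zero    = ≡.refl
map-suc-iterate k (suc t) = ≡.cong (suc k ∷_) (map-suc-iterate (suc k) t)

applyUpTo≡map-iterate : ∀ {a} {A : Set a} (f : ℕ → A) t → applyUpTo f t ≡ map f (iterate suc 0 t)
applyUpTo≡map-iterate f zero    = ≡.refl
applyUpTo≡map-iterate f (suc t) = ≡.cong (f 0 ∷_) (begin
  applyUpTo (f ∘ suc) t                ≡⟨ applyUpTo≡map-iterate (f ∘ suc) t ⟩
  map (f ∘ suc) (iterate suc 0 t)      ≡⟨ List.map-∘ (iterate suc 0 t) ⟩
  map f (map suc (iterate suc 0 t))    ≡⟨ ≡.cong (map f) (map-suc-iterate 0 t) ⟩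
  map f (iterate suc 1 t)              ∎)
  where open ≡.≡-Reasoning

HasCharacteristic2 : ∀ {c ℓ} → CommutativeRing c ℓ → Set ℓ
HasCharacteristic2 R = 1# + 1# ≈ 0#
  where open CommutativeRing R

-- Powers, units and finite fields of order 2^n

module Powers {c ℓ : Level} (R : CommutativeRing c ℓ) where
  open CommutativeRing R
  import Algebra.Properties.CommutativeSemiring.Exp commutativeSemiring as Exp

  pow≡^ : ∀ x k → pow R x k ≡ x Exp.^ k
  pow≡^ x zero    = ≡.refl
  pow≡^ x (suc k) = ≡.cong (x *_) (pow≡^ x k)

  pow-cong : ∀ k {x y} → x ≈ y → pow R x k ≈ pow R y k
  pow-cong k {x} {y} x≈y rewrite pow≡^ x k | pow≡^ y k = Exp.^-congˡ k x≈y

  pow-distrib-* : ∀ x y k → pow R (x * y) k ≈ pow R x k * pow R y k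
  pow-distrib-* x y k rewrite pow≡^ (x * y) k | pow≡^ x k | pow≡^ y k = Exp.^-distrib-* x y k

  pow-homo-* : ∀ x i j → pow R x (i ℕ.+ j) ≈ pow R x i * pow R x j
  pow-homo-* x i j rewrite pow≡^ x (i ℕ.+ j) | pow≡^ x i | pow≡^ x j = Exp.^-homo-* x i j

  pow-1# : ∀ k → pow R 1# k ≈ 1#
  pow-1# zero    = refl
  pow-1# (suc k) = trans (*-identityˡ _) (pow-1# k)

  open MonoidSum *-commutativeMonoid using () renaming (sum to ∏)
  open import Relation.Binary.Reasoning.Setoid setoid

  ∏-constant : ∀ {n} {f : Fin n → Carrier} {x} → (∀ k → f k ≈ x) → ∏ f ≈ pow R x n
  ∏-constant {zero}  _   = refl
  ∏-constant {suc n} f≈x = *-cong (f≈x Fin.zero) (∏-constant (f≈x ∘ Fin.suc))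

  ∏-all-but-one : ∀ {n} (f : Fin n → Carrier) x k₀ → f k₀ ≈ 1# → (∀ k → k ≢ k₀ → f k ≈ x) →
                  ∏ f * x ≈ pow R x n
  ∏-all-but-one {suc n} f x Fin.zero f₀≈1 rest = begin
    (f Fin.zero * ∏ (f ∘ Fin.suc)) * x ≈⟨ *-congʳ (trans (*-congʳ f₀≈1) (*-identityˡ _)) ⟩
    ∏ (f ∘ Fin.suc) * x                ≈⟨ *-comm _ x ⟩
    x * ∏ (f ∘ Fin.suc)                ≈⟨ *-congˡ (∏-constant λ k → rest (Fin.suc k) λ ()) ⟩
    x * pow R x n                      ∎
  ∏-all-but-one {suc n} f x (Fin.suc k₀) f₀≈1 rest = begin
    (f Fin.zero * ∏ (f ∘ Fin.suc)) * x ≈⟨ *-assoc _ _ x ⟩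
    f Fin.zero * (∏ (f ∘ Fin.suc) * x) ≈⟨ *-cong (rest Fin.zero λ ())
                                                  (∏-all-but-one (f ∘ Fin.suc) x k₀ f₀≈1
                                                     λ k k≢k₀ → rest (Fin.suc k) (k≢k₀ ∘ Fin.suc-injective)) ⟩
    x * pow R x n                      ∎

module Invertibility {c ℓ : Level} (R : CommutativeRing c ℓ) where
  open CommutativeRing R
  open MonoidSum *-commutativeMonoid using () renaming (sum to ∏)
  open import Relation.Binary.Reasoning.Setoid setoid

  *-invertible : ∀ {x y} → ∃-inv R x → ∃-inv R y → ∃-inv R (x * y)
  *-invertible {x} {y} (x⁻¹ , xx⁻¹≈1) (y⁻¹ , yy⁻¹≈1) = x⁻¹ * y⁻¹ , (begin
    (x * y) * (x⁻¹ * y⁻¹)   ≈⟨ solve-swap ⟩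
    (x * x⁻¹) * (y * y⁻¹)   ≈⟨ *-cong xx⁻¹≈1 yy⁻¹≈1 ⟩
    1# * 1#                 ≈⟨ *-identityˡ 1# ⟩
    1#                      ∎)
    where
    open import Algebra.Solver.CommutativeMonoid *-commutativeMonoid using (solve; _⊕_; _⊜_)
    solve-swap : (x * y) * (x⁻¹ * y⁻¹) ≈ (x * x⁻¹) * (y * y⁻¹)
    solve-swap = solve 4 (λ a b c d → (a ⊕ b) ⊕ (c ⊕ d) ⊜ (a ⊕ c) ⊕ (b ⊕ d)) refl x y x⁻¹ y⁻¹

  ∏-invertible : ∀ {n} (f : Fin n → Carrier) → (∀ k → ∃-inv R (f k)) → ∃-inv R (∏ f)
  ∏-invertible {zero}  f _     = 1# , *-identityˡ 1#
  ∏-invertible {suc n} f f-inv = *-invertible (f-inv Fin.zero) (∏-invertible (f ∘ Fin.suc) (f-inv ∘ Fin.suc))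

  *-cancelʳ-invertible : ∀ {x y z} → ∃-inv R z → x * z ≈ y * z → x ≈ y
  *-cancelʳ-invertible {x} {y} {z} (z⁻¹ , zz⁻¹≈1) xz≈yz = begin
    x                ≈⟨ *-identityʳ x ⟨
    x * 1#           ≈⟨ *-congˡ zz⁻¹≈1 ⟨
    x * (z * z⁻¹)    ≈⟨ *-assoc x z z⁻¹ ⟨
    (x * z) * z⁻¹    ≈⟨ *-congʳ xz≈yz ⟩
    (y * z) * z⁻¹    ≈⟨ *-assoc y z z⁻¹ ⟩
    y * (z * z⁻¹)    ≈⟨ *-congˡ zz⁻¹≈1 ⟩
    y * 1#           ≈⟨ *-identityʳ y ⟩
    y                ∎

module FiniteCommutativeRing {c ℓ : Level} (R : CommutativeRing c ℓ) (N : ℕ)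
  (enum : Inverse (≡.setoid (Fin N)) (CommutativeRing.setoid R)) where
  open CommutativeRing R
  open Inverse enum using (to; from; to-cong; from-cong; strictlyInverseˡ; strictlyInverseʳ)
  open Powers R
  open Invertibility R
  open import Algebra.Properties.Semiring.Mult semiring using (_×_; ×1-homo-*)
  open import Relation.Binary.Reasoning.Setoid setoid
  module + = MonoidSum +-commutativeMonoid
  open MonoidSum *-commutativeMonoid using () renaming (sum to ∏; ∑-distrib-+ to ∏-distrib-*; sum-cong-≋ to ∏-cong)

  infix 4 _≈?_
  _≈?_ : (x y : Carrier) → Dec (x ≈ y)
  x ≈? y = map′ (λ fx≡fy → trans (sym (strictlyInverseˡ x)) (trans (to-cong fx≡fy) (strictlyInverseˡ y)))
                from-cong (from x Fin.≟ from y)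

  carrierPermutation : (f g : Carrier → Carrier) →
                       (∀ {x y} → x ≈ y → f x ≈ f y) → (∀ {x y} → x ≈ y → g x ≈ g y) →
                       (∀ x → f (g x) ≈ x) → (∀ x → g (f x) ≈ x) → Inverse setoid setoid
  carrierPermutation f g f-cong g-cong fg gf = record
    { to        = f
    ; from      = g
    ; to-cong   = f-cong
    ; from-cong = g-cong
    ; inverse   = (λ {x} y≈gx → trans (f-cong y≈gx) (fg x)) , (λ {x} y≈fx → trans (g-cong y≈fx) (gf x))
    }

  ∑-invariant : ∀ {a b} (C : CommutativeMonoid a b) → let module C = CommutativeMonoid C in
                (h : Carrier → C.Carrier) → (∀ {x y} → x ≈ y → h x C.≈ h y) → (φ : Inverse setoid setoid) →
                MonoidSum.sum C (h ∘ to) C.≈ MonoidSum.sum C (h ∘ Inverse.to φ ∘ to)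
  ∑-invariant C h h-cong φ =
    C.trans (sum-permute (h ∘ to) π) (sum-cong-≋ λ k → h-cong (strictlyInverseˡ (Inverse.to φ (to k))))
    where
    module C = CommutativeMonoid C
    open MonoidSum C using (sum-permute; sum-cong-≋)
    π : Permutation N N
    π = Compose.inverse enum (Compose.inverse φ (Symmetry.inverse enum))

  -- Summing x + 1 instead of x over all x adds N copies of 1.
  N×1≈0 : N × 1# ≈ 0#
  N×1≈0 = identityʳ-unique (+.sum to) (N × 1#) (sym (begin
    +.sum to                                  ≈⟨ ∑-invariant +-commutativeMonoid (λ x → x) (λ x≈y → x≈y) shift ⟩
    +.sum (λ k → to k + 1#)                   ≈⟨ +.∑-distrib-+ to (λ _ → 1#) ⟩
    +.sum to + +.sum {N} (λ _ → 1#)           ≈⟨ +-congˡ (+.sum-replicate N) ⟩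
    +.sum to + N × 1#                         ∎))
    where
    open import Algebra.Properties.Group +-group using (identityʳ-unique)
    shift : Inverse setoid setoid
    shift = carrierPermutation (_+ 1#) (_- 1#) +-congʳ +-congʳ
      (λ x → trans (+-assoc x (- 1#) 1#) (trans (+-congˡ (-‿inverseˡ 1#)) (+-identityʳ x)))
      (λ x → trans (+-assoc x 1# (- 1#)) (trans (+-congˡ (-‿inverseʳ 1#)) (+-identityʳ x)))

  2^n×1≈[1+1]^n : ∀ n → (2 ^ n) × 1# ≈ pow R (1# + 1#) n
  2^n×1≈[1+1]^n zero    = +-identityʳ 1#
  2^n×1≈[1+1]^n (suc n) = trans (×1-homo-* 2 (2 ^ n)) (*-cong (+-congˡ (+-identityʳ 1#)) (2^n×1≈[1+1]^n n))

  characteristic-two : ∀ n → N ≡ 2 ^ n → ¬ (1# ≈ 0#) → (∀ x → ¬ (x ≈ 0#) → ∃-inv R x) →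
                       HasCharacteristic2 R
  characteristic-two n N≡2^n 1≉0 invertible with 1# + 1# ≈? 0#
  ... | yes 1+1≈0 = 1+1≈0
  ... | no  1+1≉0 with invertible _ 1+1≉0
  ...   | u , [1+1]u≈1 = ⊥-elim (1≉0 (begin
    1#                              ≈⟨ pow-1# n ⟨
    pow R 1# n                      ≈⟨ pow-cong n [1+1]u≈1 ⟨
    pow R ((1# + 1#) * u) n         ≈⟨ pow-distrib-* (1# + 1#) u n ⟩
    pow R (1# + 1#) n * pow R u n   ≈⟨ *-congʳ [1+1]^n≈0 ⟩
    0# * pow R u n                  ≈⟨ zeroˡ _ ⟩
    0#                              ∎))
    where
    [1+1]^n≈0 : pow R (1# + 1#) n ≈ 0#
    [1+1]^n≈0 = trans (sym (2^n×1≈[1+1]^n n)) (≡.subst (λ k → k × 1# ≈ 0#) N≡2^n N×1≈0)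

  module _ (invertible : ∀ x → ¬ (x ≈ 0#) → ∃-inv R x) {a a⁻¹ : Carrier} (aa⁻¹≈1 : a * a⁻¹ ≈ 1#) where

    nonzeroPart : Carrier → Carrier
    nonzeroPart x with x ≈? 0#
    ... | yes _ = 1#
    ... | no  _ = x

    scale : Carrier → Carrier
    scale x with x ≈? 0#
    ... | yes _ = 1#
    ... | no  _ = a

    nonzeroPart-cong : ∀ {x y} → x ≈ y → nonzeroPart x ≈ nonzeroPart y
    nonzeroPart-cong {x} {y} x≈y with x ≈? 0# | y ≈? 0#
    ... | yes _   | yes _   = refl
    ... | yes x≈0 | no  y≉0 = ⊥-elim (y≉0 (trans (sym x≈y) x≈0))
    ... | no  x≉0 | yes y≈0 = ⊥-elim (x≉0 (trans x≈y y≈0))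
    ... | no  _   | no  _   = x≈y

    nonzeroPart-invertible : ∀ x → ∃-inv R (nonzeroPart x)
    nonzeroPart-invertible x with x ≈? 0#
    ... | yes _   = 1# , *-identityˡ 1#
    ... | no  x≉0 = invertible x x≉0

    a*-reflects-0 : ∀ {x} → a * x ≈ 0# → x ≈ 0#
    a*-reflects-0 {x} ax≈0 = *-cancelʳ-invertible (a⁻¹ , aa⁻¹≈1) (begin
      x * a              ≈⟨ *-comm x a ⟩
      a * x              ≈⟨ ax≈0 ⟩
      0#                 ≈⟨ zeroˡ a ⟨
      0# * a             ∎)

    nonzeroPart-a* : ∀ x → nonzeroPart (a * x) ≈ scale x * nonzeroPart x
    nonzeroPart-a* x with x ≈? 0# | a * x ≈? 0#
    ... | yes _   | yes _    = sym (*-identityˡ 1#)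
    ... | yes x≈0 | no  ax≉0 = ⊥-elim (ax≉0 (trans (*-congˡ x≈0) (zeroʳ a)))
    ... | no  x≉0 | yes ax≈0 = ⊥-elim (x≉0 (a*-reflects-0 ax≈0))
    ... | no  _   | no  _    = refl

    a*-permutation : Inverse setoid setoid
    a*-permutation = carrierPermutation (a *_) (a⁻¹ *_) *-congˡ *-congˡ
      (λ x → trans (sym (*-assoc a a⁻¹ x)) (trans (*-congʳ aa⁻¹≈1) (*-identityˡ x)))
      (λ x → trans (sym (*-assoc a⁻¹ a x)) (trans (*-congʳ (trans (*-comm a⁻¹ a) aa⁻¹≈1)) (*-identityˡ x)))

    -- Multiplying by a permutes the carrier and multiplies each nonzero part by a, except at 0.
    ∏-scale≈1 : ∏ (scale ∘ to) ≈ 1#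
    ∏-scale≈1 = *-cancelʳ-invertible (∏-invertible (nonzeroPart ∘ to) (nonzeroPart-invertible ∘ to)) (begin
      ∏ (scale ∘ to) * ∏ (nonzeroPart ∘ to)        ≈⟨ ∏-distrib-* (scale ∘ to) (nonzeroPart ∘ to) ⟨
      ∏ (λ k → scale (to k) * nonzeroPart (to k))  ≈⟨ ∏-cong (λ k → sym (nonzeroPart-a* (to k))) ⟩
      ∏ (λ k → nonzeroPart (a * to k))
        ≈⟨ ∑-invariant *-commutativeMonoid nonzeroPart nonzeroPart-cong a*-permutation ⟨
      ∏ (nonzeroPart ∘ to)                         ≈⟨ *-identityˡ _ ⟨
      1# * ∏ (nonzeroPart ∘ to)                    ∎)

    fermat : pow R a N ≈ a
    fermat = begin
      pow R a N                ≈⟨ ∏-all-but-one (scale ∘ to) a (from 0#) scale-at-0 scale-elsewhere ⟨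
      ∏ (scale ∘ to) * a   ≈⟨ *-congʳ ∏-scale≈1 ⟩
      1# * a                   ≈⟨ *-identityˡ a ⟩
      a                        ∎
      where
      scale-at-0 : scale (to (from 0#)) ≈ 1#
      scale-at-0 with to (from 0#) ≈? 0#
      ... | yes _ = refl
      ... | no  ≉0 = ⊥-elim (≉0 (strictlyInverseˡ 0#))
      scale-elsewhere : ∀ k → k ≢ from 0# → scale (to k) ≈ a
      scale-elsewhere k k≢k₀ with to k ≈? 0#
      ... | yes ≈0 = ⊥-elim (k≢k₀ (≡.trans (≡.sym (strictlyInverseʳ k)) (from-cong ≈0)))
      ... | no  _  = refl

-- Determinants in characteristic 2 as permanents

module InCharacteristic2 {c ℓ : Level} (R : CommutativeRing c ℓ) (1+1≈0 : HasCharacteristic2 R) where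
  open CommutativeRing R
  open import Relation.Binary.Reasoning.Setoid setoid

  x+x≈0 : ∀ x → x + x ≈ 0#
  x+x≈0 x = begin
    x + x             ≈⟨ +-cong (*-identityˡ x) (*-identityˡ x) ⟨
    1# * x + 1# * x   ≈⟨ distribʳ x 1# 1# ⟨
    (1# + 1#) * x     ≈⟨ *-congʳ 1+1≈0 ⟩
    0# * x            ≈⟨ zeroˡ x ⟩
    0#                ∎

  -x≈x : ∀ x → - x ≈ x
  -x≈x x = begin
    - x               ≈⟨ +-identityʳ (- x) ⟨
    - x + 0#          ≈⟨ +-congˡ (x+x≈0 x) ⟨
    - x + (x + x)     ≈⟨ +-assoc (- x) x x ⟨
    (- x + x) + x     ≈⟨ +-congʳ (-‿inverseˡ x) ⟩
    0# + x            ≈⟨ +-identityˡ x ⟩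
    x                 ∎

  sgn≈1 : ∀ j → sgn R j ≈ 1#
  sgn≈1 zero    = refl
  sgn≈1 (suc j) = trans (-x≈x (sgn R j)) (sgn≈1 j)

module ColumnSums {c ℓ : Level} (R : CommutativeRing c ℓ) where
  open CommutativeRing R
  open import Algebra.Properties.CommutativeMonoid.Sum +-commutativeMonoid
    using (sum; sum-cong-≋; ∑-distrib-+; ∑-comm)
  open import Algebra.Properties.Semiring.Sum semiring using (*-distribˡ-sum)
  open import Relation.Binary.Reasoning.Setoid setoid

  infixr 8 [_]·_
  [_]·_ : Bool → Carrier → Carrier
  [ true  ]· x = x
  [ false ]· x = 0#

  []·-cong : ∀ b {x y} → x ≈ y → [ b ]· x ≈ [ b ]· y
  []·-cong true  x≈y = x≈y
  []·-cong false _   = refl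

  []·-true : ∀ {b} x → T b → [ b ]· x ≈ x
  []·-true {true} x _ = refl

  []·-vanish : ∀ b {x} → (T b → x ≈ 0#) → [ b ]· x ≈ 0#
  []·-vanish true  x≈0 = x≈0 tt
  []·-vanish false _   = refl

  []·-+ : ∀ b x y → [ b ]· (x + y) ≈ [ b ]· x + [ b ]· y
  []·-+ true  x y = refl
  []·-+ false x y = sym (+-identityˡ 0#)

  []·-*ˡ : ∀ b x y → x * [ b ]· y ≈ [ b ]· (x * y)
  []·-*ˡ true  x y = refl
  []·-*ˡ false x y = zeroʳ x

  []·-∧ : ∀ a b x → [ a ]· [ b ]· x ≈ [ a ∧ b ]· x
  []·-∧ true  b x = refl
  []·-∧ false b x = refl

  []·-∨ : ∀ a b x → (T a → T b → ⊥) → [ a ∨ b ]· x ≈ [ a ]· x + [ b ]· x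
  []·-∨ true  true  x disjoint = ⊥-elim (disjoint tt tt)
  []·-∨ true  false x _        = sym (+-identityʳ x)
  []·-∨ false b     x _        = sym (+-identityˡ _)

  sumFin-cong : ∀ k {f g : Fin k → Carrier} → (∀ j → f j ≈ g j) → sumFin R k f ≈ sumFin R k g
  sumFin-cong zero    f≈g = refl
  sumFin-cong (suc k) f≈g = +-cong (f≈g Fin.zero) (sumFin-cong k (f≈g ∘ Fin.suc))

  sumBelow : ℕ → (ℕ → Carrier) → Carrier
  sumBelow zero    f = 0#
  sumBelow (suc n) f = f 0 + sumBelow n (f ∘ suc)

  sumBelow≡sum : ∀ n f → sumBelow n f ≡ sum {n} (f ∘ toℕ)
  sumBelow≡sum zero    f = ≡.refl
  sumBelow≡sum (suc n) f = ≡.cong (f 0 +_) (sumBelow≡sum n (f ∘ suc))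

  sumBelow-cong : ∀ n {f g} → (∀ i → i < n → f i ≈ g i) → sumBelow n f ≈ sumBelow n g
  sumBelow-cong zero    f≈g = refl
  sumBelow-cong (suc n) f≈g = +-cong (f≈g 0 ℕ.z<s) (sumBelow-cong n λ i i<n → f≈g (suc i) (s≤s i<n))

  sumBelow-distrib-+ : ∀ n f g → sumBelow n (λ i → f i + g i) ≈ sumBelow n f + sumBelow n g
  sumBelow-distrib-+ n f g = begin
    sumBelow n (λ i → f i + g i)            ≡⟨ sumBelow≡sum n (λ i → f i + g i) ⟩
    sum {n} (λ x → f (toℕ x) + g (toℕ x))   ≈⟨ ∑-distrib-+ {n} (f ∘ toℕ) (g ∘ toℕ) ⟩
    sum {n} (f ∘ toℕ) + sum {n} (g ∘ toℕ)   ≡⟨ ≡.cong₂ _+_ (sumBelow≡sum n f) (sumBelow≡sum n g) ⟨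
    sumBelow n f + sumBelow n g             ∎

  *-distribˡ-sumBelow : ∀ n x f → x * sumBelow n f ≈ sumBelow n (λ i → x * f i)
  *-distribˡ-sumBelow n x f = begin
    x * sumBelow n f                  ≡⟨ ≡.cong (x *_) (sumBelow≡sum n f) ⟩
    x * sum {n} (f ∘ toℕ)             ≈⟨ *-distribˡ-sum {n} x (f ∘ toℕ) ⟩
    sum {n} (λ y → x * f (toℕ y))     ≡⟨ sumBelow≡sum n (λ i → x * f i) ⟨
    sumBelow n (λ i → x * f i)        ∎

  sumBelow-comm : ∀ n (f : ℕ → ℕ → Carrier) →
                  sumBelow n (λ i → sumBelow n (f i)) ≈ sumBelow n (λ j → sumBelow n (λ i → f i j))
  sumBelow-comm n f = begin
    sumBelow n (λ i → sumBelow n (f i))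
      ≡⟨ sumBelow≡sum n (λ i → sumBelow n (f i)) ⟩
    sum {n} (λ x → sumBelow n (f (toℕ x)))
      ≈⟨ sum-cong-≋ {n} (λ x → reflexive (sumBelow≡sum n (f (toℕ x)))) ⟩
    sum {n} (λ x → sum {n} (λ y → f (toℕ x) (toℕ y)))
      ≈⟨ ∑-comm {n} {n} (λ x y → f (toℕ x) (toℕ y)) ⟩
    sum {n} (λ y → sum {n} (λ x → f (toℕ x) (toℕ y)))
      ≈⟨ sum-cong-≋ {n} (λ y → reflexive (sumBelow≡sum n (λ i → f i (toℕ y)))) ⟨
    sum {n} (λ y → sumBelow n (λ i → f i (toℕ y)))
      ≡⟨ sumBelow≡sum n (λ j → sumBelow n (λ i → f i j)) ⟨
    sumBelow n (λ j → sumBelow n (λ i → f i j)) ∎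

  sumBelow-zero : ∀ n {f} → (∀ i → i < n → f i ≈ 0#) → sumBelow n f ≈ 0#
  sumBelow-zero zero    f≈0 = refl
  sumBelow-zero (suc n) f≈0 =
    trans (+-cong (f≈0 0 ℕ.z<s) (sumBelow-zero n (λ i i<n → f≈0 (suc i) (s≤s i<n))))
          (+-identityʳ 0#)

  []·-sumBelow : ∀ b n f → [ b ]· sumBelow n f ≈ sumBelow n (λ i → [ b ]· f i)
  []·-sumBelow true  n f = refl
  []·-sumBelow false n f = sym (sumBelow-zero n (λ _ _ → refl))

  sumBelow-point : ∀ n {f k} → k < n → (∀ i → i < n → i ≢ k → f i ≈ 0#) → sumBelow n f ≈ f k
  sumBelow-point (suc n) {f} {zero} _ off = begin
    f 0 + sumBelow n (f ∘ suc) ≈⟨ +-congˡ (sumBelow-zero n (λ i i<n → off (suc i) (s≤s i<n) λ ())) ⟩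
    f 0 + 0#                   ≈⟨ +-identityʳ (f 0) ⟩
    f 0                        ∎
  sumBelow-point (suc n) {f} {suc k} (s≤s k<n) off = begin
    f 0 + sumBelow n (f ∘ suc) ≈⟨ +-cong (off 0 ℕ.z<s λ ()) (sumBelow-point n k<n on-tail) ⟩
    0# + f (suc k)             ≈⟨ +-identityˡ (f (suc k)) ⟩
    f (suc k)                  ∎
    where
    on-tail : ∀ i → i < n → i ≢ k → f (suc i) ≈ 0#
    on-tail i i<n i≢k = off (suc i) (s≤s i<n) (i≢k ∘ ℕ.suc-injective)

  sumBelow-pair : ∀ n {f k l} → k < n → l < n → k ≢ l →
                  (∀ i → i < n → i ≢ k → i ≢ l → f i ≈ 0#) → sumBelow n f ≈ f k + f l
  sumBelow-pair n {f} {k} {l} k<n l<n k≢l off = begin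
    sumBelow n f
      ≈⟨ sumBelow-cong n (λ i _ → split (i ≡ᵇ k) (f i)) ⟩
    sumBelow n (λ i → [ i ≡ᵇ k ]· f i + [ not (i ≡ᵇ k) ]· f i)
      ≈⟨ sumBelow-distrib-+ n (λ i → [ i ≡ᵇ k ]· f i) (λ i → [ not (i ≡ᵇ k) ]· f i) ⟩
    sumBelow n (λ i → [ i ≡ᵇ k ]· f i) + sumBelow n (λ i → [ not (i ≡ᵇ k) ]· f i)
      ≈⟨ +-cong (sumBelow-point n k<n at-k) (sumBelow-point n l<n at-l) ⟩
    [ k ≡ᵇ k ]· f k + [ not (l ≡ᵇ k) ]· f l
      ≡⟨ ≡.cong₂ (λ b b′ → [ b ]· f k + [ not b′ ]· f l) (≡ᵇ-refl k) (≢⇒¬≡ᵇ (k≢l ∘ ≡.sym)) ⟩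
    f k + f l ∎
    where
    split : ∀ b x → x ≈ [ b ]· x + [ not b ]· x
    split true  x = sym (+-identityʳ x)
    split false x = sym (+-identityˡ x)
    at-k : ∀ i → i < n → i ≢ k → [ i ≡ᵇ k ]· f i ≈ 0#
    at-k i _ i≢k rewrite ≢⇒¬≡ᵇ i≢k = refl
    at-l : ∀ i → i < n → i ≢ l → [ not (i ≡ᵇ k) ]· f i ≈ 0#
    at-l i i<n i≢l = []·-vanish (not (i ≡ᵇ k)) λ t → off i i<n (λ { ≡.refl → k≢k t }) i≢l
      where
      k≢k : T (not (k ≡ᵇ k)) → ⊥
      k≢k t rewrite ≡ᵇ-refl k = t

module Permanent {c ℓ : Level} (R : CommutativeRing c ℓ) (M : ℕ) where
  open CommutativeRing R
  open ColumnSums R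
  open import Relation.Binary.Reasoning.Setoid setoid

  Row : Set c
  Row = ℕ → Carrier

  Columns : Set
  Columns = ℕ → Bool

  infixl 7 _∖_
  _∖_ : Columns → ℕ → Columns
  (A ∖ k) i = A i ∧ not (i ≡ᵇ k)

  infixl 6 _+ʳ_
  _+ʳ_ : Row → Row → Row
  (u +ʳ v) i = u i + v i

  infix 4 _≗ʳ_
  _≗ʳ_ : Row → Row → Set ℓ
  u ≗ʳ v = ∀ i → u i ≈ v i

  -- Columns are the naturals below M; A marks those still available.
  perm : List Row → Columns → Carrier
  perm []       A = 1#
  perm (r ∷ rs) A = sumBelow M λ i → [ A i ]· (r i * perm rs (A ∖ i))

  perm-congᶜ : ∀ rs {A B} → (∀ i → i < M → A i ≡ B i) → perm rs A ≈ perm rs B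
  perm-congᶜ []       _   = refl
  perm-congᶜ (r ∷ rs) {A} {B} A≡B = sumBelow-cong M term
    where
    term : ∀ i → i < M → [ A i ]· (r i * perm rs (A ∖ i)) ≈ [ B i ]· (r i * perm rs (B ∖ i))
    term i i<M rewrite A≡B i i<M =
      []·-cong (B i) (*-congˡ (perm-congᶜ rs λ j j<M → ≡.cong (_∧ not (j ≡ᵇ i)) (A≡B j j<M)))

  perm-∷-cong : ∀ r rs rs′ A → (∀ B → perm rs B ≈ perm rs′ B) → perm (r ∷ rs) A ≈ perm (r ∷ rs′) A
  perm-∷-cong r rs rs′ A rs≈rs′ = sumBelow-cong M λ i _ → []·-cong (A i) (*-congˡ (rs≈rs′ (A ∖ i)))

  perm-congʳ : ∀ {rs rs′} → Pointwise _≗ʳ_ rs rs′ → ∀ A → perm rs A ≈ perm rs′ A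
  perm-congʳ []              A = refl
  perm-congʳ (r≗r′ ∷ rs≈rs′) A =
    sumBelow-cong M λ i _ → []·-cong (A i) (*-cong (r≗r′ i) (perm-congʳ rs≈rs′ (A ∖ i)))

  perm-linear : ∀ xs u v ys A →
                perm (xs ++ u +ʳ v ∷ ys) A ≈ perm (xs ++ u ∷ ys) A + perm (xs ++ v ∷ ys) A
  perm-linear []       u v ys A = trans
    (sumBelow-cong M λ i _ → trans ([]·-cong (A i) (distribʳ _ (u i) (v i))) ([]·-+ (A i) _ _))
    (sumBelow-distrib-+ M _ _)
  perm-linear (x ∷ xs) u v ys A = trans
    (sumBelow-cong M λ i _ → trans ([]·-cong (A i) (trans (*-congˡ (perm-linear xs u v ys (A ∖ i)))
                                                          (distribˡ (x i) _ _)))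
                                   ([]·-+ (A i) _ _))
    (sumBelow-distrib-+ M _ _)

  pairTerm : Row → Row → List Row → Columns → ℕ → ℕ → Carrier
  pairTerm u v rs A i j = [ A i ∧ (A ∖ i) j ]· ((u i * v j) * perm rs (A ∖ i ∖ j))

  perm-expand₂ : ∀ u v rs A →
                 perm (u ∷ v ∷ rs) A ≈ sumBelow M (λ i → sumBelow M (pairTerm u v rs A i))
  perm-expand₂ u v rs A = sumBelow-cong M λ i _ → begin
    [ A i ]· (u i * sumBelow M (λ j → [ (A ∖ i) j ]· (v j * perm rs (A ∖ i ∖ j))))
      ≈⟨ []·-cong (A i) (*-distribˡ-sumBelow M (u i) _) ⟩
    [ A i ]· sumBelow M (λ j → u i * [ (A ∖ i) j ]· (v j * perm rs (A ∖ i ∖ j)))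
      ≈⟨ []·-sumBelow (A i) M _ ⟩
    sumBelow M (λ j → [ A i ]· (u i * [ (A ∖ i) j ]· (v j * perm rs (A ∖ i ∖ j))))
      ≈⟨ sumBelow-cong M (λ j _ → []·-cong (A i) ([]·-*ˡ ((A ∖ i) j) (u i) _)) ⟩
    sumBelow M (λ j → [ A i ]· [ (A ∖ i) j ]· (u i * (v j * perm rs (A ∖ i ∖ j))))
      ≈⟨ sumBelow-cong M (λ j _ → trans ([]·-∧ (A i) ((A ∖ i) j) _)
                                         ([]·-cong (A i ∧ (A ∖ i) j) (sym (*-assoc _ _ _)))) ⟩
    sumBelow M (pairTerm u v rs A i) ∎

  pair-available-sym : ∀ A i j → A i ∧ (A ∖ i) j ≡ A j ∧ (A ∖ j) i
  pair-available-sym A i j rewrite ≡ᵇ-sym j i with A i | A j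
  ... | true  | true  = ≡.refl
  ... | true  | false = ≡.refl
  ... | false | true  = ≡.refl
  ... | false | false = ≡.refl

  ∖-comm : ∀ A i j k → (A ∖ i ∖ j) k ≡ (A ∖ j ∖ i) k
  ∖-comm A i j k with A k | k ≡ᵇ i | k ≡ᵇ j
  ... | true  | true  | true  = ≡.refl
  ... | true  | true  | false = ≡.refl
  ... | true  | false | true  = ≡.refl
  ... | true  | false | false = ≡.refl
  ... | false | _     | _     = ≡.refl

  pairTerm-sym : ∀ u v rs A i j → pairTerm u v rs A i j ≈ pairTerm v u rs A j i
  pairTerm-sym u v rs A i j rewrite pair-available-sym A i j =
    []·-cong (A j ∧ (A ∖ j) i) (*-cong (*-comm (u i) (v j)) (perm-congᶜ rs λ k _ → ∖-comm A i j k))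

  perm-swap : ∀ u v rs A → perm (u ∷ v ∷ rs) A ≈ perm (v ∷ u ∷ rs) A
  perm-swap u v rs A = begin
    perm (u ∷ v ∷ rs) A                                        ≈⟨ perm-expand₂ u v rs A ⟩
    sumBelow M (λ i → sumBelow M (pairTerm u v rs A i))         ≈⟨ sumBelow-comm M (pairTerm u v rs A) ⟩
    sumBelow M (λ j → sumBelow M (λ i → pairTerm u v rs A i j))
      ≈⟨ sumBelow-cong M (λ j _ → sumBelow-cong M λ i _ → pairTerm-sym u v rs A i j) ⟩
    sumBelow M (λ j → sumBelow M (pairTerm v u rs A j))         ≈⟨ perm-expand₂ v u rs A ⟨
    perm (v ∷ u ∷ rs) A                                        ∎

  perm-rotate : ∀ w vs A → perm (w ∷ vs) A ≈ perm (vs ++ w ∷ []) A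
  perm-rotate w []       A = refl
  perm-rotate w (v ∷ vs) A =
    trans (perm-swap w v vs A) (perm-∷-cong v (w ∷ vs) (vs ++ w ∷ []) A (perm-rotate w vs))

  perm-single : ∀ {u k} rs A → k < M → T (A k) → (∀ i → i < M → T (A i) → i ≢ k → u i ≈ 0#) →
                perm (u ∷ rs) A ≈ u k * perm rs (A ∖ k)
  perm-single rs A k<M Ak off = trans
    (sumBelow-point M k<M λ i i<M i≢k → []·-vanish (A i) λ Ai → trans (*-congʳ (off i i<M Ai i≢k)) (zeroˡ _))
    ([]·-true _ Ak)

  perm-pair : ∀ {u k l} rs A → k < M → l < M → k ≢ l → T (A k) → T (A l) →
              (∀ i → i < M → T (A i) → i ≢ k → i ≢ l → u i ≈ 0#) →
              perm (u ∷ rs) A ≈ u k * perm rs (A ∖ k) + u l * perm rs (A ∖ l)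
  perm-pair rs A k<M l<M k≢l Ak Al off = trans
    (sumBelow-pair M k<M l<M k≢l λ i i<M i≢k i≢l →
       []·-vanish (A i) λ Ai → trans (*-congʳ (off i i<M Ai i≢k i≢l)) (zeroˡ _))
    (+-cong ([]·-true _ Ak) ([]·-true _ Al))

  image : ∀ {k} → (Fin k → Fin M) → Columns
  image {zero}  e i = false
  image {suc k} e i = (toℕ (e Fin.zero) ≡ᵇ i) ∨ image (e ∘ Fin.suc) i

  image-intro : ∀ {k} (e : Fin k → Fin M) j → T (image e (toℕ (e j)))
  image-intro e Fin.zero    rewrite ≡ᵇ-refl (toℕ (e Fin.zero)) = tt
  image-intro e (Fin.suc j) = Equivalence.from T-∨ (inj₂ (image-intro (e ∘ Fin.suc) j))

  image-elim : ∀ {k} (e : Fin k → Fin M) {i} → T (image e i) → ∃ λ j → toℕ (e j) ≡ i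
  image-elim {suc k} e {i} t with Equivalence.to (T-∨ {toℕ (e Fin.zero) ≡ᵇ i}) t
  ... | inj₁ e₀≡i = Fin.zero , ℕ.≡ᵇ⇒≡ _ _ e₀≡i
  ... | inj₂ rest with image-elim (e ∘ Fin.suc) rest
  ...   | j , eⱼ≡i = Fin.suc j , eⱼ≡i

  image-punchIn : ∀ {k} (e : Fin (suc k) → Fin M) → Injective _≡_ _≡_ e → ∀ j i →
                  image (e ∘ punchIn j) i ≡ (image e ∖ toℕ (e j)) i
  image-punchIn e inj j i = T-ext forth back
    where
    forth : T (image (e ∘ punchIn j) i) → T ((image e ∖ toℕ (e j)) i)
    forth t with image-elim (e ∘ punchIn j) t
    ... | s , ≡.refl = Equivalence.from T-∧
      ( image-intro e (punchIn j s)
      , ≢⇒T¬≡ᵇ λ eq → Fin.punchInᵢ≢i j s (inj (Fin.toℕ-injective eq)) )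
    back : T ((image e ∖ toℕ (e j)) i) → T (image (e ∘ punchIn j) i)
    back t with Equivalence.to (T-∧ {image e i}) t
    ... | t₁ , t₂ with image-elim e t₁
    ...   | j′ , ≡.refl = ≡.subst (λ x → T (image (e ∘ punchIn j) (toℕ (e x))))
                                  (Fin.punchIn-punchOut j≢j′) (image-intro (e ∘ punchIn j) (punchOut j≢j′))
      where
      j≢j′ : j ≢ j′
      j≢j′ j≡j′ = ¬≡ᵇ⇒≢ t₂ (≡.cong (toℕ ∘ e) (≡.sym j≡j′))

  sumFin-reindex : ∀ {k} (e : Fin k → Fin M) → Injective _≡_ _≡_ e → (g : ℕ → Carrier) →
                   sumFin R k (λ j → g (toℕ (e j))) ≈ sumBelow M (λ i → [ image e i ]· g i)
  sumFin-reindex {zero}  e inj g = sym (sumBelow-zero M λ _ _ → refl)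
  sumFin-reindex {suc k} e inj g = begin
    g e₀ + sumFin R k (λ j → g (toℕ (e (Fin.suc j))))
      ≈⟨ +-cong at-e₀ (sumFin-reindex (e ∘ Fin.suc) (Fin.suc-injective ∘ inj) g) ⟩
    sumBelow M (λ i → [ e₀ ≡ᵇ i ]· g i) + sumBelow M (λ i → [ image (e ∘ Fin.suc) i ]· g i)
      ≈⟨ sumBelow-distrib-+ M (λ i → [ e₀ ≡ᵇ i ]· g i) (λ i → [ image (e ∘ Fin.suc) i ]· g i) ⟨
    sumBelow M (λ i → [ e₀ ≡ᵇ i ]· g i + [ image (e ∘ Fin.suc) i ]· g i)
      ≈⟨ sumBelow-cong M (λ i _ → sym ([]·-∨ (e₀ ≡ᵇ i) _ (g i) (disjoint i))) ⟩
    sumBelow M (λ i → [ image e i ]· g i) ∎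
    where
    e₀ : ℕ
    e₀ = toℕ (e Fin.zero)
    off : ∀ i → i < M → i ≢ e₀ → [ e₀ ≡ᵇ i ]· g i ≈ 0#
    off i _ i≢e₀ rewrite ≢⇒¬≡ᵇ (i≢e₀ ∘ ≡.sym) = refl
    at-e₀ : g e₀ ≈ sumBelow M (λ i → [ e₀ ≡ᵇ i ]· g i)
    at-e₀ = sym (trans (sumBelow-point M (Fin.toℕ<n (e Fin.zero)) off)
                       ([]·-true (g e₀) (≡.subst T (≡.sym (≡ᵇ-refl e₀)) tt)))
    disjoint : ∀ i → T (e₀ ≡ᵇ i) → T (image (e ∘ Fin.suc) i) → ⊥
    disjoint i t t′ with ℕ.≡ᵇ⇒≡ e₀ i t | image-elim (e ∘ Fin.suc) t′
    ... | ≡.refl | j , eⱼ≡e₀ with inj (Fin.toℕ-injective eⱼ≡e₀)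
    ... | ()

module PermanentInCharacteristic2 {c ℓ : Level} (R : CommutativeRing c ℓ) (M : ℕ)
  (1+1≈0 : HasCharacteristic2 R) where
  open CommutativeRing R
  open ColumnSums R
  open Permanent R M
  open InCharacteristic2 R 1+1≈0
  open import Relation.Binary.Reasoning.Setoid setoid

  -- Off-diagonal terms cancel in pairs.
  sumBelow-symmetric : ∀ n (f : ℕ → ℕ → Carrier) → (∀ i j → f i j ≈ f j i) → (∀ i → f i i ≈ 0#) →
                       sumBelow n (λ i → sumBelow n (f i)) ≈ 0#
  sumBelow-symmetric zero    f sym-f diag = refl
  sumBelow-symmetric (suc n) f sym-f diag = begin
    (f 0 0 + X) + sumBelow n (λ i → f (suc i) 0 + Z i)
      ≈⟨ +-cong (+-congʳ (diag 0)) (sumBelow-distrib-+ n (λ i → f (suc i) 0) Z) ⟩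
    (0# + X) + (sumBelow n (λ i → f (suc i) 0) + sumBelow n Z)
      ≈⟨ +-cong (+-identityˡ X) (+-cong (sumBelow-cong n λ i _ → sym-f (suc i) 0)
                                        (sumBelow-symmetric n (λ i j → f (suc i) (suc j))
                                                            (λ i j → sym-f (suc i) (suc j)) (diag ∘ suc))) ⟩
    X + (X + 0#)  ≈⟨ +-congˡ (+-identityʳ X) ⟩
    X + X         ≈⟨ x+x≈0 X ⟩
    0#            ∎
    where
    X : Carrier
    X = sumBelow n (λ j → f 0 (suc j))
    Z : ℕ → Carrier
    Z i = sumBelow n (λ j → f (suc i) (suc j))

  perm-repeated-head : ∀ u rs A → perm (u ∷ u ∷ rs) A ≈ 0#
  perm-repeated-head u rs A = trans (perm-expand₂ u u rs A)
    (sumBelow-symmetric M (pairTerm u u rs A) (pairTerm-sym u u rs A) diag)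
    where
    diag : ∀ i → pairTerm u u rs A i i ≈ 0#
    diag i rewrite ≡ᵇ-refl i with A i
    ... | true  = refl
    ... | false = refl

  perm-repeated-row : ∀ u xs ys A → perm (u ∷ xs ++ u ∷ ys) A ≈ 0#
  perm-repeated-row u []       ys A = perm-repeated-head u ys A
  perm-repeated-row u (x ∷ xs) ys A = trans (perm-swap u x (xs ++ u ∷ ys) A)
    (sumBelow-zero M λ i _ → []·-vanish (A i) λ _ →
       trans (*-congˡ (perm-repeated-row u xs ys (A ∖ i))) (zeroʳ (x i)))

  perm-add-head : ∀ u ps vs A → perm (u ∷ ps ++ map (u +ʳ_) vs) A ≈ perm (u ∷ ps ++ vs) A
  perm-add-head u ps []       A = refl
  perm-add-head u ps (v ∷ vs) A = begin
    perm (u ∷ ps ++ u +ʳ v ∷ map (u +ʳ_) vs) A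
      ≈⟨ perm-linear (u ∷ ps) u v (map (u +ʳ_) vs) A ⟩
    perm (u ∷ ps ++ u ∷ map (u +ʳ_) vs) A + perm (u ∷ ps ++ v ∷ map (u +ʳ_) vs) A
      ≈⟨ +-cong (perm-repeated-row u ps (map (u +ʳ_) vs) A) (moved (perm-add-head u (ps ++ v ∷ []) vs A)) ⟩
    0# + perm (u ∷ ps ++ v ∷ vs) A
      ≈⟨ +-identityˡ _ ⟩
    perm (u ∷ ps ++ v ∷ vs) A ∎
    where
    moved : ∀ {ws} → perm (u ∷ (ps ++ v ∷ []) ++ ws) A ≈ perm (u ∷ (ps ++ v ∷ []) ++ vs) A →
            perm (u ∷ ps ++ v ∷ ws) A ≈ perm (u ∷ ps ++ v ∷ vs) A
    moved {ws} rewrite List.++-assoc ps (v ∷ []) ws | List.++-assoc ps (v ∷ []) vs = λ eq → eq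

  det≈perm-image : ∀ k (ρ : ℕ → Row) (e : Fin k → Fin M) → Injective _≡_ _≡_ e →
                   det R k (λ r s → ρ (toℕ r) (toℕ (e s))) ≈ perm (applyUpTo ρ k) (image e)
  det≈perm-image zero    ρ e inj = refl
  det≈perm-image (suc k) ρ e inj = begin
    sumFin R (suc k) (λ j → sgn R (toℕ j) * (ρ 0 (toℕ (e j)) * minor j))
      ≈⟨ sumFin-cong (suc k) (λ j → trans (*-congʳ (sgn≈1 (toℕ j)))
                                   (trans (*-identityˡ (ρ 0 (toℕ (e j)) * minor j)) (*-congˡ (minor≈perm j)))) ⟩
    sumFin R (suc k) (λ j → g (toℕ (e j)))
      ≈⟨ sumFin-reindex e inj g ⟩
    perm (applyUpTo ρ (suc k)) (image e) ∎
    where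
    rest : List Row
    rest = applyUpTo (ρ ∘ suc) k
    minor : Fin (suc k) → Carrier
    minor j = det R k (λ r s → ρ (suc (toℕ r)) (toℕ (e (punchIn j s))))
    g : ℕ → Carrier
    g i = ρ 0 i * perm rest (image e ∖ i)
    minor≈perm : ∀ j → minor j ≈ perm rest (image e ∖ toℕ (e j))
    minor≈perm j = trans (det≈perm-image k (ρ ∘ suc) (e ∘ punchIn j) (Fin.punchIn-injective j _ _ ∘ inj))
                         (perm-congᶜ rest λ i _ → image-punchIn e inj j i)

  det≈perm : ∀ (ρ : ℕ → Row) → det R M (λ r s → ρ (toℕ r) (toℕ s)) ≈ perm (applyUpTo ρ M) (λ _ → true)
  det≈perm ρ = trans (det≈perm-image M ρ (λ x → x) (λ eq → eq)) (perm-congᶜ (applyUpTo ρ M) image-all)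
    where
    image-all : ∀ i → i < M → image (λ x → x) i ≡ true
    image-all i i<M = Equivalence.to T-≡
      (≡.subst (T ∘ image (λ x → x)) (Fin.toℕ-fromℕ< i<M) (image-intro (λ x → x) (Fin.fromℕ< i<M)))

-- The all-ones matrix plus a bidiagonal band

module BandRecurrences {c ℓ : Level} (R : CommutativeRing c ℓ) (d : ℕ → CommutativeRing.Carrier R) where
  open CommutativeRing R

  ∏d : ℕ → ℕ → Carrier
  ∏d k zero    = 1#
  ∏d k (suc t) = d k * ∏d (suc k) t

  bandsOnes : ℕ → ℕ → Carrier
  bandsOnes k zero    = 1#
  bandsOnes k (suc t) = d k * bandsOnes (suc k) t + d (suc k) * ∏d (suc (suc k)) t

  onesPlusBands : ℕ → ℕ → Carrier
  onesPlusBands k zero    = 1#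
  onesPlusBands k (suc t) = bandsOnes k t + d k * onesPlusBands (suc k) t

module OnesPlusBand {c ℓ : Level} (R : CommutativeRing c ℓ) (M : ℕ)
  (1+1≈0 : HasCharacteristic2 R)
  (d : ℕ → CommutativeRing.Carrier R) where
  open CommutativeRing R
  open ColumnSums R
  open Permanent R M
  open PermanentInCharacteristic2 R M 1+1≈0
  open BandRecurrences R d
  open import Relation.Binary.Reasoning.Setoid setoid

  ones : Row
  ones _ = 1#

  band : ℕ → Row
  band r i = [ (r ≡ᵇ suc i) ∨ (i ≡ᵇ r) ]· d i

  bands : ℕ → ℕ → List Row
  bands k t = map band (iterate suc k t)

  band-diag : ∀ r → band r r ≈ d r
  band-diag r rewrite ≢⇒¬≡ᵇ (ℕ.<⇒≢ (ℕ.n<1+n r)) | ≡ᵇ-refl r = refl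

  band-sub : ∀ i → band (suc i) i ≈ d i
  band-sub i rewrite ≡ᵇ-refl i = refl

  band-off : ∀ {r i} → i ≢ r → suc i ≢ r → band r i ≈ 0#
  band-off i≢r 1+i≢r rewrite ≢⇒¬≡ᵇ (1+i≢r ∘ ≡.sym) | ≢⇒¬≡ᵇ i≢r = refl

  atLeast : ℕ → Columns
  atLeast k i = not (i <ᵇ k)

  atLeast⇒≤ : ∀ {k i} → T (atLeast k i) → k ≤ i
  atLeast⇒≤ {zero}  {i}     _ = z≤n
  atLeast⇒≤ {suc k} {suc i} t = s≤s (atLeast⇒≤ t)

  ≤⇒atLeast : ∀ {k i} → k ≤ i → T (atLeast k i)
  ≤⇒atLeast z≤n       = tt
  ≤⇒atLeast (s≤s k≤i) = ≤⇒atLeast k≤i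

  infixl 6 _∪_
  _∪_ : Columns → ℕ → Columns
  (A ∪ e) i = A i ∨ (i ≡ᵇ e)

  atLeast-∖ : ∀ k i → (atLeast k ∖ k) i ≡ atLeast (suc k) i
  atLeast-∖ zero    zero    = ≡.refl
  atLeast-∖ zero    (suc i) = ≡.refl
  atLeast-∖ (suc k) zero    = ≡.refl
  atLeast-∖ (suc k) (suc i) = atLeast-∖ k i

  atLeast-∖-suc : ∀ k i → (atLeast k ∖ suc k) i ≡ (atLeast (suc (suc k)) ∪ k) i
  atLeast-∖-suc zero    zero          = ≡.refl
  atLeast-∖-suc zero    (suc zero)    = ≡.refl
  atLeast-∖-suc zero    (suc (suc i)) = ≡.refl
  atLeast-∖-suc (suc k) zero          = ≡.refl
  atLeast-∖-suc (suc k) (suc i)       = atLeast-∖-suc k i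

  ∪-∖ : ∀ {e k} i → e < k → ((atLeast k ∪ e) ∖ k) i ≡ (atLeast (suc k) ∪ e) i
  ∪-∖ {zero}  {suc k} zero    _ = ≡.refl
  ∪-∖ {zero}  {suc k} (suc i) _
    rewrite ∨-identityʳ (atLeast k i) | ∨-identityʳ (atLeast (suc k) i) = atLeast-∖ k i
  ∪-∖ {suc e} {suc k} zero    _ = ≡.refl
  ∪-∖ {suc e} {suc k} (suc i) (s≤s e<k) = ∪-∖ i e<k

  ∪⇒≤⊎≡ : ∀ {k e i} → T ((atLeast k ∪ e) i) → k ≤ i ⊎ i ≡ e
  ∪⇒≤⊎≡ {k} {e} {i} t with Equivalence.to (T-∨ {atLeast k i}) t
  ... | inj₁ k≤i = inj₁ (atLeast⇒≤ k≤i)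
  ... | inj₂ i≡e = inj₂ (ℕ.≡ᵇ⇒≡ i e i≡e)

  k+1+t≡M⇒k<M : ∀ k t → k ℕ.+ suc t ≡ M → k < M
  k+1+t≡M⇒k<M k t eq = ≡.subst (k <_) eq (ℕ.m<m+n k ℕ.z<s)

  k+1+t≡M⇒1+k+t≡M : ∀ k t → k ℕ.+ suc t ≡ M → suc k ℕ.+ t ≡ M
  k+1+t≡M⇒1+k+t≡M k t eq = ≡.trans (≡.sym (ℕ.+-suc k t)) eq

  -- The last row of ones must take the isolated column e: columns e + 1 .. i - 1 are gone.
  perm-bands-ones-gap : ∀ t i e → suc e < i → i ℕ.+ t ≡ M →
                        perm (bands i t ++ ones ∷ []) (atLeast i ∪ e) ≈ ∏d i t
  perm-bands-ones-gap zero i e 1+e<i i+0≡M =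
    trans (perm-single [] (atLeast i ∪ e) e<M avail-e off) (*-identityˡ 1#)
    where
    i≡M : i ≡ M
    i≡M = ≡.trans (≡.sym (ℕ.+-identityʳ i)) i+0≡M
    e<M : e < M
    e<M = ≡.subst (e <_) i≡M (ℕ.<-trans (ℕ.n<1+n e) 1+e<i)
    avail-e : T ((atLeast i ∪ e) e)
    avail-e = Equivalence.from (T-∨ {atLeast i e}) (inj₂ (≡.subst T (≡.sym (≡ᵇ-refl e)) tt))
    off : ∀ j → j < M → T ((atLeast i ∪ e) j) → j ≢ e → ones j ≈ 0#
    off j j<M avail j≢e with ∪⇒≤⊎≡ {i} avail
    ... | inj₁ i≤j = ⊥-elim (ℕ.<⇒≱ j<M (≡.subst (_≤ j) i≡M i≤j))
    ... | inj₂ j≡e = ⊥-elim (j≢e j≡e)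
  perm-bands-ones-gap (suc t) i e 1+e<i eq = begin
    perm (band i ∷ bands (suc i) t ++ ones ∷ []) (atLeast i ∪ e)
      ≈⟨ perm-single rest (atLeast i ∪ e) (k+1+t≡M⇒k<M i t eq) avail-i off ⟩
    band i i * perm rest ((atLeast i ∪ e) ∖ i)
      ≈⟨ *-cong (band-diag i) (perm-congᶜ rest λ j _ → ∪-∖ j e<i) ⟩
    d i * perm rest (atLeast (suc i) ∪ e)
      ≈⟨ *-congˡ (perm-bands-ones-gap t (suc i) e (ℕ.<-trans 1+e<i (ℕ.n<1+n i)) (k+1+t≡M⇒1+k+t≡M i t eq)) ⟩
    d i * ∏d (suc i) t ∎
    where
    rest : List Row
    rest = bands (suc i) t ++ ones ∷ []
    e<i : e < i
    e<i = ℕ.<-trans (ℕ.n<1+n e) 1+e<i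
    avail-i : T ((atLeast i ∪ e) i)
    avail-i = Equivalence.from (T-∨ {atLeast i i}) (inj₁ (≤⇒atLeast (ℕ.≤-refl {i})))
    off : ∀ j → j < M → T ((atLeast i ∪ e) j) → j ≢ i → band i j ≈ 0#
    off j _ avail j≢i with ∪⇒≤⊎≡ {i} avail
    ... | inj₁ i≤j    = band-off j≢i (ℕ.>⇒≢ (s≤s i≤j))
    ... | inj₂ ≡.refl = band-off j≢i (ℕ.<⇒≢ 1+e<i)

  perm-bands-ones : ∀ t k → suc k ℕ.+ t ≡ M → perm (bands (suc k) t ++ ones ∷ []) (atLeast k) ≈ bandsOnes k t
  perm-bands-ones zero k eq =
    trans (perm-single [] (atLeast k) k<M (≤⇒atLeast (ℕ.≤-refl {k})) off) (*-identityˡ 1#)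
    where
    1+k≡M : suc k ≡ M
    1+k≡M = ≡.trans (≡.sym (ℕ.+-identityʳ (suc k))) eq
    k<M : k < M
    k<M = ≡.subst (k <_) 1+k≡M (ℕ.n<1+n k)
    off : ∀ j → j < M → T (atLeast k j) → j ≢ k → ones j ≈ 0#
    off j j<M avail j≢k =
      ⊥-elim (j≢k (ℕ.≤-antisym (ℕ.<⇒≤pred (≡.subst (j <_) (≡.sym 1+k≡M) j<M)) (atLeast⇒≤ avail)))
  perm-bands-ones (suc t) k eq = begin
    perm (band (suc k) ∷ rest) (atLeast k)
      ≈⟨ perm-pair rest (atLeast k) k<M 1+k<M (ℕ.<⇒≢ (ℕ.n<1+n k))
                   (≤⇒atLeast (ℕ.≤-refl {k})) (≤⇒atLeast (ℕ.n≤1+n k)) off ⟩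
    band (suc k) k * perm rest (atLeast k ∖ k) + band (suc k) (suc k) * perm rest (atLeast k ∖ suc k)
      ≈⟨ +-cong (*-cong (band-sub k) (perm-congᶜ rest λ j _ → atLeast-∖ k j))
                (*-cong (band-diag (suc k)) (perm-congᶜ rest λ j _ → atLeast-∖-suc k j)) ⟩
    d k * perm rest (atLeast (suc k)) + d (suc k) * perm rest (atLeast (suc (suc k)) ∪ k)
      ≈⟨ +-cong (*-congˡ (perm-bands-ones t (suc k) (k+1+t≡M⇒1+k+t≡M (suc k) t eq)))
                (*-congˡ (perm-bands-ones-gap t (suc (suc k)) k (ℕ.n<1+n (suc k)) (k+1+t≡M⇒1+k+t≡M (suc k) t eq))) ⟩
    bandsOnes k (suc t) ∎
    where
    rest : List Row
    rest = bands (suc (suc k)) t ++ ones ∷ []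
    1+k<M : suc k < M
    1+k<M = k+1+t≡M⇒k<M (suc k) t eq
    k<M : k < M
    k<M = ℕ.<-trans (ℕ.n<1+n k) 1+k<M
    off : ∀ j → j < M → T (atLeast k j) → j ≢ k → j ≢ suc k → band (suc k) j ≈ 0#
    off j _ _ j≢k j≢1+k = band-off j≢1+k (j≢k ∘ ℕ.suc-injective)

  perm-ones+bands : ∀ t k → k ℕ.+ t ≡ M → perm (map (ones +ʳ_) (bands k t)) (atLeast k) ≈ onesPlusBands k t
  perm-ones+bands zero    k _  = refl
  perm-ones+bands (suc t) k eq = begin
    perm (ones +ʳ band k ∷ rest) (atLeast k)
      ≈⟨ perm-linear [] ones (band k) rest (atLeast k) ⟩
    perm (ones ∷ rest) (atLeast k) + perm (band k ∷ rest) (atLeast k)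
      ≈⟨ +-cong (perm-add-head ones [] (bands (suc k) t) (atLeast k))
                (perm-single rest (atLeast k) (k+1+t≡M⇒k<M k t eq) (≤⇒atLeast (ℕ.≤-refl {k})) off) ⟩
    perm (ones ∷ bands (suc k) t) (atLeast k) + band k k * perm rest (atLeast k ∖ k)
      ≈⟨ +-cong (perm-rotate ones (bands (suc k) t) (atLeast k))
                (*-cong (band-diag k) (perm-congᶜ rest λ j _ → atLeast-∖ k j)) ⟩
    perm (bands (suc k) t ++ ones ∷ []) (atLeast k) + d k * perm rest (atLeast (suc k))
      ≈⟨ +-cong (perm-bands-ones t k (k+1+t≡M⇒1+k+t≡M k t eq))
                (*-congˡ (perm-ones+bands t (suc k) (k+1+t≡M⇒1+k+t≡M k t eq))) ⟩
    onesPlusBands k (suc t) ∎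
    where
    rest : List Row
    rest = map (ones +ʳ_) (bands (suc k) t)
    off : ∀ j → j < M → T (atLeast k j) → j ≢ k → band k j ≈ 0#
    off j _ avail j≢k = band-off j≢k (ℕ.>⇒≢ (s≤s (atLeast⇒≤ avail)))
module PartialSums {c ℓ : Level} (R : CommutativeRing c ℓ) (e : ℕ → CommutativeRing.Carrier R) where
  open CommutativeRing R

  segment : ℕ → ℕ → Carrier
  segment k zero    = 0#
  segment k (suc t) = e k + segment (suc k) t

  alternating : ℕ → ℕ → Carrier
  alternating k zero          = 0#
  alternating k (suc zero)    = e k
  alternating k (suc (suc t)) = e k + alternating (suc (suc k)) t

  segment-split : ∀ k t → segment k (suc t) ≈ alternating k (suc t) + alternating (suc k) t
  segment-split k zero    = refl
  segment-split k (suc t) = trans (+-congˡ (segment-split (suc k) t))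
    (solve 3 (λ x y z → x ⊕ (y ⊕ z) ⊜ (x ⊕ z) ⊕ y) refl
             (e k) (alternating (suc k) (suc t)) (alternating (suc (suc k)) t))
    where open import Algebra.Solver.CommutativeMonoid +-commutativeMonoid using (solve; _⊕_; _⊜_)

module BandClosedForms {c ℓ : Level} (R : CommutativeRing c ℓ)
  (1+1≈0 : HasCharacteristic2 R)
  (d e : ℕ → CommutativeRing.Carrier R)
  (de≈1 : ∀ k → CommutativeRing._≈_ R (CommutativeRing._*_ R (d k) (e (suc k))) (CommutativeRing.1# R)) where
  open CommutativeRing R
  open InCharacteristic2 R 1+1≈0
  open BandRecurrences R d
  open PartialSums R e
  open import Relation.Binary.Reasoning.Setoid setoid

  bandsOnes-closed : ∀ k t → bandsOnes k t ≈ ∏d k (suc t) * segment (suc k) (suc t)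
  bandsOnes-closed k zero = sym (begin
    (d k * 1#) * (e (suc k) + 0#) ≈⟨ *-cong (*-identityʳ (d k)) (+-identityʳ (e (suc k))) ⟩
    d k * e (suc k)               ≈⟨ de≈1 k ⟩
    1#                            ∎)
  bandsOnes-closed k (suc t) = begin
    d k * bandsOnes (suc k) t + Q         ≈⟨ +-congʳ (*-congˡ (bandsOnes-closed (suc k) t)) ⟩
    d k * (Q * S) + Q                     ≈⟨ +-cong (*-assoc (d k) Q S) We≈Q ⟨
    W * S + W * e (suc k)                 ≈⟨ +-comm _ _ ⟩
    W * e (suc k) + W * S                 ≈⟨ distribˡ W (e (suc k)) S ⟨
    W * (e (suc k) + S)                   ∎
    where
    Q S W : Carrier
    Q = ∏d (suc k) (suc t)
    S = segment (suc (suc k)) (suc t)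
    W = d k * Q
    We≈Q : W * e (suc k) ≈ Q
    We≈Q = begin
      (d k * Q) * e (suc k)   ≈⟨ *-congʳ (*-comm (d k) Q) ⟩
      (Q * d k) * e (suc k)   ≈⟨ *-assoc Q (d k) (e (suc k)) ⟩
      Q * (d k * e (suc k))   ≈⟨ *-congˡ (de≈1 k) ⟩
      Q * 1#                  ≈⟨ *-identityʳ Q ⟩
      Q                       ∎

  onesPlusBands-closed : ∀ k t → onesPlusBands k t ≈ ∏d k t * (1# + alternating (suc k) t)
  onesPlusBands-closed k zero    = sym (trans (*-identityˡ _) (+-identityʳ 1#))
  onesPlusBands-closed k (suc t) = begin
    bandsOnes k t + d k * onesPlusBands (suc k) t
      ≈⟨ +-cong (bandsOnes-closed k t) (*-congˡ (onesPlusBands-closed (suc k) t)) ⟩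
    W * segment (suc k) (suc t) + d k * (∏d (suc k) t * (1# + A′))
      ≈⟨ +-congˡ (*-assoc (d k) _ _) ⟨
    W * segment (suc k) (suc t) + W * (1# + A′)
      ≈⟨ distribˡ W _ _ ⟨
    W * (segment (suc k) (suc t) + (1# + A′))
      ≈⟨ *-congˡ (+-congʳ (segment-split (suc k) t)) ⟩
    W * ((A + A′) + (1# + A′))
      ≈⟨ *-congˡ (solve 3 (λ x y z → (x ⊕ y) ⊕ (z ⊕ y) ⊜ (z ⊕ x) ⊕ (y ⊕ y)) refl A A′ 1#) ⟩
    W * ((1# + A) + (A′ + A′))
      ≈⟨ *-congˡ (trans (+-congˡ (x+x≈0 A′)) (+-identityʳ _)) ⟩
    W * (1# + A) ∎
    where
    open import Algebra.Solver.CommutativeMonoid +-commutativeMonoid using (solve; _⊕_; _⊜_)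
    W A A′ : Carrier
    W = ∏d k (suc t)
    A = alternating (suc k) (suc t)
    A′ = alternating (suc (suc k)) t

-- The minor p̃_{n-1}

module Frobenius {c ℓ : Level} (R : CommutativeRing c ℓ) where
  open CommutativeRing R
  open Powers R
  open Invertibility R
  open import Relation.Binary.Reasoning.Setoid setoid

  frob-inverse : ∀ {x y} s → x * y ≈ 1# → frob R x s * frob R y s ≈ 1#
  frob-inverse {x} {y} s xy≈1 = trans (sym (pow-distrib-* x y (2 ^ s))) (trans (pow-cong (2 ^ s) xy≈1) (pow-1# (2 ^ s)))

  frob-square : ∀ x s → frob R x s * frob R x s ≈ frob R x (suc s)
  frob-square x s = begin
    frob R x s * frob R x s      ≈⟨ pow-homo-* x (2 ^ s) (2 ^ s) ⟨
    pow R x (2 ^ s ℕ.+ 2 ^ s)    ≡⟨ ≡.cong (λ e → pow R x (2 ^ s ℕ.+ e)) (ℕ.+-identityʳ (2 ^ s)) ⟨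
    frob R x (suc s)             ∎

  ∏frob-telescope : ∀ x k t →
                    BandRecurrences.∏d R (frob R x ∘ suc) k t * frob R x (suc k) ≈ frob R x (t ℕ.+ suc k)
  ∏frob-telescope x k zero    = *-identityˡ _
  ∏frob-telescope x k (suc t) = begin
    (d k * ∏d (suc k) t) * d k  ≈⟨ *-congʳ (*-comm (d k) _) ⟩
    (∏d (suc k) t * d k) * d k  ≈⟨ *-assoc _ (d k) (d k) ⟩
    ∏d (suc k) t * (d k * d k)  ≈⟨ *-congˡ (frob-square x (suc k)) ⟩
    ∏d (suc k) t * d (suc k)    ≈⟨ ∏frob-telescope x (suc k) t ⟩
    frob R x (t ℕ.+ suc (suc k)) ≡⟨ ≡.cong (frob R x) (ℕ.+-suc t (suc k)) ⟩
    frob R x (suc t ℕ.+ suc k)  ∎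
    where
    d : ℕ → Carrier
    d = frob R x ∘ suc
    open BandRecurrences R d

  -- x^2 x^4 ⋯ x^(2^m) = x^(2^(m+1) - 2), which is x⁻¹ once x^(2^(m+1)) = x.
  ∏frob≈inverse : ∀ {x x⁻¹} m → x * x⁻¹ ≈ 1# → frob R x (suc m) ≈ x →
                  BandRecurrences.∏d R (frob R x ∘ suc) 0 m ≈ x⁻¹
  ∏frob≈inverse {x} {x⁻¹} m xx⁻¹≈1 fermat = begin
    P                 ≈⟨ *-identityʳ P ⟨
    P * 1#            ≈⟨ *-congˡ xx⁻¹≈1 ⟨
    P * (x * x⁻¹)     ≈⟨ *-assoc P x x⁻¹ ⟨
    (P * x) * x⁻¹     ≈⟨ *-congʳ Px≈1 ⟩
    1# * x⁻¹          ≈⟨ *-identityˡ x⁻¹ ⟩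
    x⁻¹               ∎
    where
    P : Carrier
    P = BandRecurrences.∏d R (frob R x ∘ suc) 0 m
    Px≈1 : P * x ≈ 1#
    Px≈1 = *-cancelʳ-invertible (x⁻¹ , xx⁻¹≈1) (begin
      (P * x) * x        ≈⟨ *-assoc P x x ⟩
      P * (x * x)        ≈⟨ *-congˡ (*-congˡ (*-identityʳ x)) ⟨
      P * frob R x 1     ≈⟨ ∏frob-telescope x 0 m ⟩
      frob R x (m ℕ.+ 1) ≡⟨ ≡.cong (frob R x) (ℕ.+-comm m 1) ⟩
      frob R x (suc m)   ≈⟨ fermat ⟩
      x                  ≈⟨ *-identityˡ x ⟨
      1# * x             ∎)

module _ {c ℓ : Level} (R : CommutativeRing c ℓ) (x : CommutativeRing.Carrier R) where
  open CommutativeRing R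
  open PartialSums R (frob R x)

  bracket-odd : ∀ k t → k % 2 ≡ 0 → t % 2 ≡ 0 →
                bracket R x (filter (λ i → i % 2 ℕ.≟ 1) (iterate suc k t)) ≈ alternating (suc k) t
  bracket-odd k zero          _    _    = refl
  bracket-odd k (suc (suc t)) even even-t
    rewrite even | %2≡0⇒suc%2≡1 k even = +-congˡ (bracket-odd (suc (suc k)) t even even-t)

module PTilde {c ℓ : Level} (F : CommutativeRing c ℓ)
  (1+1≈0 : HasCharacteristic2 F)
  (m : ℕ) (a : CommutativeRing.Carrier F) where
  open CommutativeRing F
  open Permanent F m
  open PermanentInCharacteristic2 F m 1+1≈0
  open BandRecurrences F (frob F a ∘ suc)
  open OnesPlusBand F m 1+1≈0 (frob F a ∘ suc)
  open import Relation.Binary.Reasoning.Setoid setoid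

  row : ℕ → Row
  row i j = Dmat F (suc m) a i (suc j)

  -- Only row n - 1 wraps around (D_{n-1,0} = 1 + a), and it is deleted.
  row≗ones+band : ∀ i → i < m → row i ≗ʳ ones +ʳ band i
  row≗ones+band i i<m j rewrite ℕ.m<n⇒m%n≡m {n = suc m} (s≤s i<m) with i ≡ᵇ suc j in p | j ≡ᵇ i in q
  ... | true  | _     rewrite ℕ.≡ᵇ⇒≡ i (suc j) (≡.subst T (≡.sym p) tt) = refl
  ... | false | true  rewrite ℕ.≡ᵇ⇒≡ j i (≡.subst T (≡.sym q) tt) = refl
  ... | false | false = sym (+-identityʳ 1#)

  rows≗ones+bands : ∀ t k → k ℕ.+ t ≡ m → Pointwise _≗ʳ_ (map row (iterate suc k t)) (map (ones +ʳ_) (bands k t))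
  rows≗ones+bands zero    k _  = []
  rows≗ones+bands (suc t) k eq =
    row≗ones+band k (k+1+t≡M⇒k<M k t eq) ∷ rows≗ones+bands t (suc k) (k+1+t≡M⇒1+k+t≡M k t eq)

  ptilde≈onesPlusBands : ptilde F (suc m) a ≈ onesPlusBands 0 m
  ptilde≈onesPlusBands = begin
    ptilde F (suc m) a                             ≈⟨ det≈perm row ⟩
    perm (applyUpTo row m) (atLeast 0)             ≡⟨ ≡.cong (λ rs → perm rs (atLeast 0)) (applyUpTo≡map-iterate row m) ⟩
    perm (map row (iterate suc 0 m)) (atLeast 0)   ≈⟨ perm-congʳ (rows≗ones+bands m 0 ≡.refl) (atLeast 0) ⟩
    perm (map (ones +ʳ_) (bands 0 m)) (atLeast 0)  ≈⟨ perm-ones+bands m 0 ≡.refl ⟩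
    onesPlusBands 0 m                              ∎

lemma6 : {c ℓ : Level} (F : CommutativeRing c ℓ) →
         let open CommutativeRing F in
         ¬ (1# ≈ 0#) →
         (∀ x → ¬ (x ≈ 0#) → ∃-inv F x) →
         (n : ℕ) →
         Inverse (≡.setoid (Fin (2 ^ n))) setoid →
         n % 2 ≡ 1 →
         (a inva : Carrier) → a * inva ≈ 1# →
         tr F n inva ≈ 1# →
         ptilde F n a ≈ inva * (1# + bracket F inva (oddIdx F n))
lemma6 F _ _ zero _ () _ _ _ _
lemma6 F 1≉0 invertible (suc m) enum n-odd a a⁻¹ aa⁻¹≈1 _ = begin
  ptilde F (suc m) a                                  ≈⟨ PTilde.ptilde≈onesPlusBands F 1+1≈0 m a ⟩
  onesPlusBands 0 m                                   ≈⟨ onesPlusBands-closed 0 m ⟩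
  ∏d 0 m * (1# + alternating 1 m)                     ≈⟨ *-cong ∏d≈a⁻¹ (+-congˡ (sym odd-part)) ⟩
  a⁻¹ * (1# + bracket F a⁻¹ (oddIdx F (suc m)))       ∎
  where
  open CommutativeRing F
  open Relation.Binary.Reasoning.Setoid setoid
  open FiniteCommutativeRing F (2 ^ suc m) enum
  open BandRecurrences F (frob F a ∘ suc)
  open PartialSums F (frob F a⁻¹)
  1+1≈0 : HasCharacteristic2 F
  1+1≈0 = characteristic-two (suc m) ≡.refl 1≉0 invertible
  open BandClosedForms F 1+1≈0 (frob F a ∘ suc) (frob F a⁻¹) (λ k → Frobenius.frob-inverse F (suc k) aa⁻¹≈1)
  ∏d≈a⁻¹ : ∏d 0 m ≈ a⁻¹
  ∏d≈a⁻¹ = Frobenius.∏frob≈inverse F m aa⁻¹≈1 (fermat invertible aa⁻¹≈1)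
  odd-part : bracket F a⁻¹ (oddIdx F (suc m)) ≈ alternating 1 m
  odd-part rewrite applyUpTo≡map-iterate (λ i → i) m | List.map-id (iterate suc 0 m) =
    bracket-odd F a⁻¹ 0 m ≡.refl (suc%2≡1⇒%2≡0 m n-odd)
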